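{- Let $\alpha$ be an irrational point of $\mathbb{R}/\mathbb{Z}$, let $n\ge1$ and $1\le m\le a_n$, and suppose $$\beta=\frac{mp_{n-1}+p_{n-2}}{mq_{n-1}+q_{n-2}}\in E_n(\alpha)$$ is a nonzero point of $\mathbb{Q}/\mathbb{Z}$. - If $n$ is odd, then $\beta'=\frac{p_{n-1}}{q_{n-1}}$, $\beta''=\frac{(m-1)p_{n-1}+p_{n-2}}{(m-1)q_{n-1}+q_{n-2}}$, and $\alpha\in I(\beta',\beta)$. - If $n$ is even, then $\beta'=\frac{(m-1)p_{n-1}+p_{n-2}}{(m-1)q_{n-1}+q_{n-2}}$, $\beta''=\frac{p_{n-1}}{q_{n-1}}$, and $\alpha\in I(\beta,\beta'')$. All fractions are taken in $\mathbb{Q}/\mathbb{Z}$.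
   Context: Every $\beta\in\mathbb{Q}/\mathbb{Z}$ can be written $\beta=a/q$ with $q\ge1$ and $\gcd(a,q)=1$; its height is $h(\beta)=q$. Put $\mathcal{F}_Q=\{\beta:h(\beta)\le Q\}$. For distinct $a,b\in\mathbb{R}/\mathbb{Z}$, $I(a,b)$ is the open arc from $a$ to $b$ in the positive direction, i.e. $\{a+t\bmod1:0<t<d\}$ with $d\in(0,1)$, $d\equiv b-a\pmod1$. For $\beta\ne0$ with $h(\beta)=Q$: $\beta'$ is the unique point of $\mathcal{F}_Q$ with $I(\beta',\beta)\cap\mathcal{F}_Q=\emptyset$, and $\beta''$ is the unique point of $\mathcal{F}_Q$ with $I(\beta,\beta'')\cap\mathcal{F}_Q=\emptyset$. Identify an irrational $\alpha$ with its representative in $(0,1)$ and write $\alpha=[0;a_1,a_2,\dots]$. Set $p_{ -2}=0$, $q_{ -2}=1$, $p_{ -1}=1$, $q_{ -1}=0$, and for $n\ge0$ set $p_n=a_np_{n-1}+p_{n-2}$ and $q_n=a_nq_{n-1}+q_{n-2}$, with $a_0=0$. For $n\ge1$, $E_n(\alpha)=\{(mp_{n-1}+p_{n-2})/(mq_{n-1}+q_{n-2}):1\le m\le a_n\}$. -}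

module Defs where

open import Data.Nat as ℕ using (ℕ; zero; suc; _∸_)
open import Data.Integer as ℤ using (ℤ; +_)
open import Data.Rational as ℚ using (ℚ; _/_; floor; ↧ₙ_; 0ℚ)
open import Data.Product using (_×_; ∃)
open import Data.Sum using (_⊎_)
open import Relation.Binary.PropositionalEquality using (_≡_)
open import Relation.Nullary using (¬_)

-- ℚ/ℤ, represented by rationals modulo 1

red : ℚ → ℚ
red x = x ℚ.- (floor x / 1)

_≡₁_ : ℚ → ℚ → Set
x ≡₁ y = red x ≡ red y

h : ℚ → ℕ
h x = ↧ₙ (red x)

-- x ∈ I(a,b) for rational points a, b, x of ℚ/ℤ
-- (x - a mod 1) lies strictly between 0 and (b - a mod 1)
InArc : ℚ → ℚ → ℚ → Set
InArc a b x = (0ℚ ℚ.< red (x ℚ.- a)) × (red (x ℚ.- a) ℚ.< red (b ℚ.- a))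

IsPrev : ℕ → ℚ → ℚ → Set
IsPrev Q β γ = (h γ ℕ.≤ Q) × (¬ (γ ≡₁ β)) × (∀ x → h x ℕ.≤ Q → ¬ InArc γ β x)

IsNext : ℕ → ℚ → ℚ → Set
IsNext Q β γ = (h γ ℕ.≤ Q) × (¬ (γ ≡₁ β)) × (∀ x → h x ℕ.≤ Q → ¬ InArc β γ x)

-- An irrational α ∈ (0,1) is given by its
-- partial quotients a_1, a_2, ... (all ≥ 1); the function a : ℕ → ℕ
-- gives a_k = a k for k ≥ 1, and a_0 is fixed to 0 (the value a 0 is ignored).

digit : (ℕ → ℕ) → ℕ → ℕ
digit a zero    = 0
digit a (suc k) = a (suc k)

-- P a k = p_{k-2},  Q a k = q_{k-2}   (k ≥ 0)
P : (ℕ → ℕ) → ℕ → ℕ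
P a zero = 0
P a (suc zero) = 1
P a (suc (suc k)) = digit a k ℕ.* P a (suc k) ℕ.+ P a k

Qd : (ℕ → ℕ) → ℕ → ℕ
Qd a zero = 1
Qd a (suc zero) = 0
Qd a (suc (suc k)) = digit a k ℕ.* Qd a (suc k) ℕ.+ Qd a k

-- the rational u/v (with the harmless convention u/0 := 0; all
-- denominators used below are positive whenever they matter)
frac : ℕ → ℕ → ℚ
frac u zero    = 0ℚ
frac u (suc v) = (+ u) / suc v

-- p_j / q_j  for j ≥ -1, written with index j+1 : conv a i = p_{i-1}/q_{i-1}
conv : (ℕ → ℕ) → ℕ → ℚ
conv a i = frac (P a (suc i)) (Qd a (suc i))

interm : (ℕ → ℕ) → ℕ → ℕ → ℚ
interm a n m = frac (m ℕ.* P a (suc n) ℕ.+ P a n) (m ℕ.* Qd a (suc n) ℕ.+ Qd a n)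

-- The real number α = [0; a_1, a_2, ...] as a Dedekind cut:
-- x < α  iff  x < p_{2k}/q_{2k} for some k  (even convergents increase to α)
-- α < x  iff  p_{2k+1}/q_{2k+1} < x for some k (odd convergents decrease to α)

_<α[_] : ℚ → (ℕ → ℕ) → Set
x <α[ a ] = ∃ λ k → x ℚ.< conv a (suc (2 ℕ.* k))

α[_]<_ : (ℕ → ℕ) → ℚ → Set
α[ a ]< x = ∃ λ k → conv a (suc (suc (2 ℕ.* k))) ℚ.< x

αInArc : (ℕ → ℕ) → ℚ → ℚ → Set
αInArc a u v =
  ((red u ℚ.< red v) × (red u <α[ a ]) × (α[ a ]< red v))
  ⊎ ((red v ℚ.< red u) × ((red u <α[ a ]) ⊎ (α[ a ]< red v)))

-- Since p_{n-1} q_{n-2} - p_{n-2} q_{n-1} = ±1, the intermediate fraction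
-- β = (m p_{n-1} + p_{n-2}) / (m q_{n-1} + q_{n-2}) is a Farey neighbour of
-- p_{n-1}/q_{n-1} and of the preceding intermediate fraction.  Hence β is in
-- lowest terms, its height Q is its denominator, and both neighbours have
-- denominators at most Q.  Every fraction strictly between Farey neighbours
-- u/v < u'/v' has denominator at least v + v' > Q, so no point of F_Q lies
-- between β and either neighbour.  The position of α comes from the
-- alternating monotonicity of convergents and intermediate fractions: even
-- convergents increase and odd ones decrease towards α.

module Submission where

open import Defs
open import Data.Nat as ℕ
  using (ℕ; zero; suc; _≤_; _<_; _+_; _*_; _∸_; _%_; z≤n; s≤s; _≤′_; ≤′-refl; ≤′-step)
import Data.Nat.Properties as ℕP
import Data.Nat.DivMod as ℕD
open import Data.Nat.Divisibility using (_∣_; ∣1⇒≡1; ∣m+n∣m⇒∣n; ∣m⇒∣m*n; ∣n⇒∣m*n; ∣-refl)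
open import Data.Nat.Coprimality using (Coprime; 0-coprimeTo-m⇒m≡1)
open import Data.Nat.Tactic.RingSolver using (solve)
open import Data.Integer as ℤ using (+_; +[1+_]; -[1+_]; 0ℤ; 1ℤ)
import Data.Integer.Properties as ℤP
import Data.Integer.DivMod as ℤD
open import Data.Integer.Tactic.RingSolver using () renaming (solve to ℤ-solve)
open import Data.Rational as ℚ using (ℚ; mkℚ; _/_; floor; ↧ₙ_; 0ℚ; 1ℚ; toℚᵘ)
import Data.Rational.Properties as ℚP
open import Data.Rational.Solver using (module +-*-Solver)
open +-*-Solver using (_:+_; _:-_; _:=_) renaming (solve to ℚ-solve)
open import Data.Rational.Unnormalised as ℚᵘ using (mkℚᵘ) renaming (_≃_ to _≃ᵘ_)
import Data.Rational.Unnormalised.Properties as ℚᵘP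
open import Data.Product using (_×_; _,_; proj₁; proj₂; ∃)
open import Data.Sum using (_⊎_; inj₁; inj₂)
open import Data.List using (_∷_; [])
open import Data.Empty using (⊥-elim)
open import Relation.Nullary using (¬_)
open import Relation.Binary.PropositionalEquality

toℚᵘ-/ : ∀ n d → toℚᵘ (n / suc d) ≃ᵘ mkℚᵘ n d
toℚᵘ-/ n d = ℚP.toℚᵘ-fromℚᵘ (mkℚᵘ n d)

frac-< : ∀ {u v u' v'} → 1 ≤ v → 1 ≤ v' → u * v' < u' * v → frac u v ℚ.< frac u' v'
frac-< {u} {suc v} {u'} {suc v'} _ _ lt = ℚP.toℚᵘ-cancel-<
  (ℚᵘP.<-respˡ-≃ (ℚᵘP.≃-sym (toℚᵘ-/ (+ u) v)) (ℚᵘP.<-respʳ-≃ (ℚᵘP.≃-sym (toℚᵘ-/ (+ u') v'))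
    (ℚᵘ.*<* (subst₂ ℤ._<_ (ℤP.pos-* u (suc v')) (ℤP.pos-* u' (suc v)) (ℤ.+<+ lt)))))

frac-≤ : ∀ {u v u' v'} → 1 ≤ v → 1 ≤ v' → u * v' ≤ u' * v → frac u v ℚ.≤ frac u' v'
frac-≤ {u} {suc v} {u'} {suc v'} _ _ le = ℚP.toℚᵘ-cancel-≤
  (ℚᵘP.≤-respˡ-≃ (ℚᵘP.≃-sym (toℚᵘ-/ (+ u) v)) (ℚᵘP.≤-respʳ-≃ (ℚᵘP.≃-sym (toℚᵘ-/ (+ u') v'))
    (ℚᵘ.*≤* (subst₂ ℤ._≤_ (ℤP.pos-* u (suc v')) (ℤP.pos-* u' (suc v)) (ℤ.+≤+ le)))))

frac-nonneg : ∀ {u v} → 1 ≤ v → 0ℚ ℚ.≤ frac u v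
frac-nonneg {u} {v} 1≤v = frac-≤ {0} {1} {u} {v} (s≤s z≤n) 1≤v z≤n

frac-pos : ∀ {u v} → 1 ≤ u → 1 ≤ v → 0ℚ ℚ.< frac u v
frac-pos {u} {v} 1≤u 1≤v = frac-< {0} {1} {u} {v} (s≤s z≤n) 1≤v (subst (1 ≤_) (sym (ℕP.*-identityʳ u)) 1≤u)

frac-<1 : ∀ {u v} → 1 ≤ v → u < v → frac u v ℚ.< 1ℚ
frac-<1 {u} {v} 1≤v u<v =
  frac-< {u} {v} {1} {1} 1≤v (s≤s z≤n) (subst₂ _<_ (sym (ℕP.*-identityʳ u)) (sym (ℕP.*-identityˡ v)) u<v)

frac-≤1 : ∀ {u v} → 1 ≤ v → u ≤ v → frac u v ℚ.≤ 1ℚ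
frac-≤1 {u} {v} 1≤v u≤v =
  frac-≤ {u} {v} {1} {1} 1≤v (s≤s z≤n) (subst₂ _≤_ (sym (ℕP.*-identityʳ u)) (sym (ℕP.*-identityˡ v)) u≤v)

-- Reduction modulo 1

i<suc[j]⇒i≤j : ∀ {i j} → i ℤ.< ℤ.suc j → i ℤ.≤ j
i<suc[j]⇒i≤j {i} {j} lt = subst (i ℤ.≤_) (ℤP.pred-suc j) (ℤP.i<j⇒i≤pred[j] lt)

div-unique : ∀ {Z k} d → k ℤ.* +[1+ d ] ℤ.≤ Z → Z ℤ.< ℤ.suc k ℤ.* +[1+ d ] → Z ℤ./ +[1+ d ] ≡ k
div-unique {Z} {k} d lo hi = ℤP.≤-antisym (i<suc[j]⇒i≤j q<1+k) (i<suc[j]⇒i≤j k<1+q)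
  where
  q = Z ℤ./ +[1+ d ]
  Z<[1+q]*D : Z ℤ.< ℤ.suc q ℤ.* +[1+ d ]
  Z<[1+q]*D = subst (λ t → Z ℤ.< ℤ.suc t ℤ.* +[1+ d ]) (sym (ℤD.div-pos-is-/ℕ Z (suc d)))
                (ℤD.n<s[n/ℕd]*d Z (suc d))
  q<1+k : q ℤ.< ℤ.suc k
  q<1+k = ℤP.*-cancelʳ-<-nonNeg +[1+ d ] (ℤP.≤-<-trans (ℤD.[n/d]*d≤n Z +[1+ d ]) hi)
  k<1+q : k ℤ.< ℤ.suc q
  k<1+q = ℤP.*-cancelʳ-<-nonNeg +[1+ d ] (ℤP.≤-<-trans lo Z<[1+q]*D)

floor-unique : ∀ z k → k / 1 ℚ.≤ z → z ℚ.< 1ℚ ℚ.+ k / 1 → floor z ≡ k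
floor-unique z@(mkℚ Z d _) k k≤z z<1+k = div-unique d lo hi
  where
  1+k*1≡[1+k]*1 : (1ℤ ℤ.+ k ℤ.* 1ℤ) ℤ.* 1ℤ ≡ ℤ.suc k ℤ.* 1ℤ
  1+k*1≡[1+k]*1 = cong (λ t → (1ℤ ℤ.+ t) ℤ.* 1ℤ) (ℤP.*-identityʳ k)
  toℚᵘ[1+k] : toℚᵘ (1ℚ ℚ.+ k / 1) ≃ᵘ mkℚᵘ (ℤ.suc k) 0
  toℚᵘ[1+k] = ℚᵘP.≃-trans (ℚP.toℚᵘ-homo-+ 1ℚ (k / 1))
    (ℚᵘP.≃-trans (ℚᵘP.+-congʳ (toℚᵘ 1ℚ) (toℚᵘ-/ k 0)) (ℚᵘ.*≡* 1+k*1≡[1+k]*1))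
  lo : k ℤ.* +[1+ d ] ℤ.≤ Z
  lo with ℚᵘP.≤-respˡ-≃ (toℚᵘ-/ k 0) (ℚP.toℚᵘ-mono-≤ k≤z)
  ... | ℚᵘ.*≤* k≤Z = subst (_ ℤ.≤_) (ℤP.*-identityʳ Z) k≤Z
  hi : Z ℤ.< ℤ.suc k ℤ.* +[1+ d ]
  hi with ℚᵘP.<-respʳ-≃ toℚᵘ[1+k] (ℚP.toℚᵘ-mono-< z<1+k)
  ... | ℚᵘ.*<* Z<1+k = subst (ℤ._< _) (ℤP.*-identityʳ Z) Z<1+k

red-+-integer : ∀ {w} k → 0ℚ ℚ.≤ w → w ℚ.< 1ℚ → red (w ℚ.+ k / 1) ≡ w
red-+-integer {w} k 0≤w w<1 = begin
  red (w ℚ.+ K)    ≡⟨ cong (λ f → (w ℚ.+ K) ℚ.- f / 1) (floor-unique (w ℚ.+ K) k K≤w+K w+K<1+K) ⟩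
  (w ℚ.+ K) ℚ.- K  ≡⟨ ℚ-solve 2 (λ w K → (w :+ K) :- K := w) refl w K ⟩
  w                ∎
  where
  open ≡-Reasoning
  K = k / 1
  K≤w+K : K ℚ.≤ w ℚ.+ K
  K≤w+K = subst (ℚ._≤ w ℚ.+ K) (ℚP.+-identityˡ K) (ℚP.+-monoˡ-≤ K 0≤w)
  w+K<1+K : w ℚ.+ K ℚ.< 1ℚ ℚ.+ K
  w+K<1+K = ℚP.+-monoˡ-< K w<1

red-fixed : ∀ {w} → 0ℚ ℚ.≤ w → w ℚ.< 1ℚ → red w ≡ w
red-fixed {w} 0≤w w<1 = subst (λ z → red z ≡ w) (ℚP.+-identityʳ w) (red-+-integer 0ℤ 0≤w w<1)

red-frac : ∀ {u v} → u < v → red (frac u v) ≡ frac u v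
red-frac {u} {v} u<v = red-fixed (frac-nonneg {u} 1≤v) (frac-<1 {u} 1≤v u<v)
  where
  1≤v : 1 ≤ v
  1≤v = ℕP.≤-trans (s≤s z≤n) u<v

0≤floor : ∀ {y} → 0ℚ ℚ.≤ y → 0ℤ ℤ.≤ floor y
0≤floor {mkℚ (+ n) d _} _ = ℤD.0≤n⇒0≤n/d (+ n) +[1+ d ] (ℤ.+≤+ z≤n) (ℤ.+≤+ z≤n)
0≤floor {mkℚ -[1+ n ] d _} (ℚ.*≤* ())

red-≤ : ∀ {y} → 0ℚ ℚ.≤ y → red y ℚ.≤ y
red-≤ {y} 0≤y = begin
  red y          ≡⟨ ℚP.+-identityʳ (red y) ⟨
  red y ℚ.+ 0ℚ   ≤⟨ ℚP.+-monoʳ-≤ (red y) 0≤F ⟩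
  red y ℚ.+ F    ≡⟨ ℚ-solve 2 (λ y F → (y :- F) :+ F := y) refl y F ⟩
  y              ∎
  where
  open ℚP.≤-Reasoning
  F = floor y / 1
  0≤F : 0ℚ ℚ.≤ F
  0≤F = ℚP.toℚᵘ-cancel-≤ (ℚᵘP.≤-respʳ-≃ (ℚᵘP.≃-sym (toℚᵘ-/ (floor y) 0))
          (ℚᵘ.*≤* (subst (0ℤ ℤ.≤_) (sym (ℤP.*-identityʳ (floor y))) (0≤floor 0≤y))))

InArc⇒between : ∀ {γ β x} → 0ℚ ℚ.≤ γ → γ ℚ.≤ β → β ℚ.≤ 1ℚ →
                InArc γ β x → γ ℚ.< red x × red x ℚ.< β
InArc⇒between {γ} {β} {x} 0≤γ γ≤β β≤1 (0<s , s<red[β-γ]) =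
  subst (γ ℚ.<_) (sym red-x) γ<γ+s , subst (ℚ._< β) (sym red-x) γ+s<β
  where
  s = red (x ℚ.- γ)
  F = floor (x ℚ.- γ) / 1
  γ<γ+s : γ ℚ.< γ ℚ.+ s
  γ<γ+s = subst (ℚ._< γ ℚ.+ s) (ℚP.+-identityʳ γ) (ℚP.+-monoʳ-< γ 0<s)
  0≤β-γ : 0ℚ ℚ.≤ β ℚ.- γ
  0≤β-γ = subst (ℚ._≤ β ℚ.- γ) (ℚP.+-inverseʳ γ) (ℚP.+-monoˡ-≤ (ℚ.- γ) γ≤β)
  γ+s<β : γ ℚ.+ s ℚ.< β
  γ+s<β = subst (γ ℚ.+ s ℚ.<_) (ℚ-solve 2 (λ γ β → γ :+ (β :- γ) := β) refl γ β)
            (ℚP.+-monoʳ-< γ (ℚP.<-≤-trans s<red[β-γ] (red-≤ 0≤β-γ)))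
  red-x : red x ≡ γ ℚ.+ s
  red-x = subst (λ z → red z ≡ γ ℚ.+ s) (ℚ-solve 3 (λ x γ F → (γ :+ ((x :- γ) :- F)) :+ F := x) refl x γ F)
            (red-+-integer (floor (x ℚ.- γ)) (ℚP.≤-trans 0≤γ (ℚP.<⇒≤ γ<γ+s)) (ℚP.<-≤-trans γ+s<β β≤1))

h-frac : ∀ {u v} → Coprime u v → u ≤ v → h (frac u v) ≡ v
h-frac {v = zero} c z≤n with () ← 0-coprimeTo-m⇒m≡1 c
h-frac {u} {suc v} c u≤v with ℕP.m≤n⇒m<n∨m≡n u≤v
... | inj₁ u<v = trans (cong ↧ₙ_ (red-frac {u} u<v)) (cong ↧ₙ_ (ℚP.normalize-coprime c))
-- u = v forces v = 1, and red (frac 1 1) = 0ℚ has denominator 1.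
... | inj₂ refl with refl ← c (∣-refl , ∣-refl) = refl

frac-proper : ∀ {u v} → Coprime u v → u ≤ v → ¬ (frac u v ≡₁ 0ℚ) → 1 ≤ u × u < v
frac-proper {zero} c _ ≢0 with refl ← 0-coprimeTo-m⇒m≡1 c = ⊥-elim (≢0 refl)
frac-proper {suc u} c u≤v ≢0 with ℕP.m≤n⇒m<n∨m≡n u≤v
... | inj₁ u<v = s≤s z≤n , u<v
... | inj₂ refl with refl ← c (∣-refl , ∣-refl) = ⊥-elim (≢0 refl)

-- Farey neighbours

record Adjacent (u v u' v' : ℕ) : Set where
  constructor adjacent
  field determinant : u' * v ≡ 1 + u * v'

module _ {u v u' v' : ℕ} (adj : Adjacent u v u' v') where

  adjacent-common-divisor : ∀ {d} → d ∣ u' * v → d ∣ u * v' → d ≡ 1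
  adjacent-common-divisor {d} d∣u'v d∣uv' =
    ∣1⇒≡1 (∣m+n∣m⇒∣n (subst (d ∣_) (trans (Adjacent.determinant adj) (ℕP.+-comm 1 (u * v'))) d∣u'v) d∣uv')

  adjacent⇒coprimeˡ : Coprime u v
  adjacent⇒coprimeˡ (d∣u , d∣v) = adjacent-common-divisor (∣n⇒∣m*n u' d∣v) (∣m⇒∣m*n v' d∣u)

  adjacent⇒coprimeʳ : Coprime u' v'
  adjacent⇒coprimeʳ (d∣u' , d∣v') = adjacent-common-divisor (∣m⇒∣m*n v d∣u') (∣n⇒∣m*n u d∣v')

  adjacent⇒coprime-denominators : Coprime v v'
  adjacent⇒coprime-denominators (d∣v , d∣v') = adjacent-common-divisor (∣n⇒∣m*n u' d∣v) (∣n⇒∣m*n u d∣v')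

adjacent⇒1≤v : ∀ {u v u' v'} → Adjacent u v u' v' → 1 ≤ v
adjacent⇒1≤v {v = suc _} _ = s≤s z≤n
adjacent⇒1≤v {v = zero} {u'} (adjacent det) = ⊥-elim (ℕP.0≢1+n (trans (sym (ℕP.*-zeroʳ u')) det))

adjacent⇒1≤v' : ∀ {u v u' v'} → Adjacent u v u' v' → u' ≤ v' → 1 ≤ v'
adjacent⇒1≤v' {v' = suc _} _ _ = s≤s z≤n
adjacent⇒1≤v' {v' = zero} (adjacent det) z≤n = ⊥-elim (ℕP.0≢1+n det)

adjacent-numerator-< : ∀ {u v u' v'} → Adjacent u v u' v' → u' ≤ v' → u < v
adjacent-numerator-< {u} {v} {u'} {v'} (adjacent det) u'≤v' = ℕP.*-cancelʳ-< v' u v (begin-strict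
  u * v'      <⟨ ℕP.n<1+n (u * v') ⟩
  1 + u * v'  ≡⟨ det ⟨
  u' * v      ≤⟨ ℕP.*-monoˡ-≤ v u'≤v' ⟩
  v' * v      ≡⟨ ℕP.*-comm v' v ⟩
  v * v'      ∎)
  where open ℕP.≤-Reasoning

adjacent-numerator-≤ : ∀ {u v u' v'} → Adjacent u v u' v' → 1 ≤ u → u < v → u' ≤ v'
adjacent-numerator-≤ {u} {v} {u'} {zero} (adjacent det) 1≤u u<v =
  ⊥-elim (ℕP.<-irrefl (sym (ℕP.m*n≡1⇒n≡1 u' v (trans det (cong suc (ℕP.*-zeroʳ u))))) (ℕP.≤-<-trans 1≤u u<v))
adjacent-numerator-≤ {u} {v@(suc _)} {u'} {v'@(suc _)} (adjacent det) _ u<v = ℕP.*-cancelʳ-≤ u' v' v (begin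
  u' * v        ≡⟨ det ⟩
  1 + u * v'    ≤⟨ ℕP.+-monoˡ-≤ (u * v') (s≤s z≤n) ⟩
  suc u * v'    ≤⟨ ℕP.*-monoˡ-≤ v' u<v ⟩
  v * v'        ≡⟨ ℕP.*-comm v v' ⟩
  v' * v        ∎)
  where open ℕP.≤-Reasoning

adjacent⇒< : ∀ {u v u' v'} → Adjacent u v u' v' → 1 ≤ v' → frac u v ℚ.< frac u' v'
adjacent⇒< {u} {v} {u'} {v'} adj@(adjacent det) 1≤v' =
  frac-< (adjacent⇒1≤v adj) 1≤v' (subst (u * v' <_) (sym det) (ℕP.n<1+n (u * v')))

i<j⇒1≤j-i : ∀ {i j} → i ℤ.< j → 1ℤ ℤ.≤ j ℤ.- i
i<j⇒1≤j-i {i} {j} i<j = subst (ℤ._≤ j ℤ.- i) [1+i]-i≡1 (ℤP.+-monoˡ-≤ (ℤ.- i) (ℤP.i<j⇒suc[i]≤j i<j))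
  where
  [1+i]-i≡1 : (1ℤ ℤ.+ i) ℤ.- i ≡ 1ℤ
  [1+i]-i≡1 = ℤ-solve (i ∷ [])

mediant-bound : ∀ {U V U' V' Y D} .{{_ : ℤ.NonNegative V}} .{{_ : ℤ.NonNegative V'}} →
  U' ℤ.* V ≡ 1ℤ ℤ.+ U ℤ.* V' → U ℤ.* D ℤ.< Y ℤ.* V → Y ℤ.* V' ℤ.< U' ℤ.* D → V ℤ.+ V' ℤ.≤ D
mediant-bound {U} {V} {U'} {V'} {Y} {D} det left right = begin
  V ℤ.+ V'                                                         ≡⟨ ℤ-solve (V ∷ V' ∷ []) ⟩
  V ℤ.* 1ℤ ℤ.+ V' ℤ.* 1ℤ                                           ≤⟨ ℤP.+-mono-≤ (ℤP.*-monoˡ-≤-nonNeg V (i<j⇒1≤j-i right))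
                                                                                  (ℤP.*-monoˡ-≤-nonNeg V' (i<j⇒1≤j-i left)) ⟩
  V ℤ.* (U' ℤ.* D ℤ.- Y ℤ.* V') ℤ.+ V' ℤ.* (Y ℤ.* V ℤ.- U ℤ.* D) ≡⟨ ℤ-solve (U ∷ V ∷ U' ∷ V' ∷ Y ∷ D ∷ []) ⟩
  D ℤ.* (U' ℤ.* V ℤ.- U ℤ.* V')                                    ≡⟨ cong (λ t → D ℤ.* (t ℤ.- U ℤ.* V')) det ⟩
  D ℤ.* (1ℤ ℤ.+ U ℤ.* V' ℤ.- U ℤ.* V')                             ≡⟨ ℤ-solve (U ∷ V' ∷ D ∷ []) ⟩
  D                                                                ∎
  where open ℤP.≤-Reasoning

between-adjacent⇒v+v'≤denominator : ∀ {u v u' v'} → Adjacent u (suc v) u' (suc v') → ∀ y →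
  frac u (suc v) ℚ.< y → y ℚ.< frac u' (suc v') → suc v + suc v' ≤ ↧ₙ y
between-adjacent⇒v+v'≤denominator {u} {v} {u'} {v'} adj y@(mkℚ Y d _) γ<y y<β =
  ℤP.drop‿+≤+ (subst (ℤ._≤ +[1+ d ]) (sym (ℤP.pos-+ (suc v) (suc v')))
    (mediant-bound {+ u} {+ suc v} {+ u'} {+ suc v'} {Y} detℤ left right))
  where
  detℤ : + u' ℤ.* + suc v ≡ 1ℤ ℤ.+ + u ℤ.* + suc v'
  detℤ = begin
    + u' ℤ.* + suc v         ≡⟨ ℤP.pos-* u' (suc v) ⟨
    + (u' * suc v)           ≡⟨ cong +_ (Adjacent.determinant adj) ⟩
    + (1 + u * suc v')       ≡⟨ ℤP.pos-+ 1 (u * suc v') ⟩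
    1ℤ ℤ.+ + (u * suc v')    ≡⟨ cong (ℤ._+_ 1ℤ) (ℤP.pos-* u (suc v')) ⟩
    1ℤ ℤ.+ + u ℤ.* + suc v'  ∎
    where open ≡-Reasoning
  left : + u ℤ.* +[1+ d ] ℤ.< Y ℤ.* + suc v
  left = ℚP.drop-*<* (subst (ℚ._< y) (ℚP.normalize-coprime {u} {v} (adjacent⇒coprimeˡ adj)) γ<y)
  right : Y ℤ.* + suc v' ℤ.< + u' ℤ.* +[1+ d ]
  right = ℚP.drop-*<* (subst (y ℚ.<_) (ℚP.normalize-coprime {u'} {v'} (adjacent⇒coprimeʳ adj)) y<β)

adjacent⇒consecutive : ∀ {u v u' v' Q} → Adjacent u v u' v' → u' ≤ v' →
  2 ≤ Q → v ≤ Q → v' ≤ Q → Q < v + v' →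
  IsPrev Q (frac u' v') (frac u v) × IsNext Q (frac u v) (frac u' v')
adjacent⇒consecutive {v = zero} adj _ _ _ _ _ with () ← adjacent⇒1≤v adj
adjacent⇒consecutive {v' = zero} adj u'≤v' _ _ _ _ with () ← adjacent⇒1≤v' adj u'≤v'
adjacent⇒consecutive {u} {suc v} {u'} {suc v'} {Q} adj u'≤v' 2≤Q v≤Q v'≤Q Q<v+v' =
  (hγ≤Q , γ≢β , no-point-between) , (hβ≤Q , (λ β≡γ → γ≢β (sym β≡γ)) , no-point-between)
  where
  γ = frac u (suc v)
  β = frac u' (suc v')
  hγ : h γ ≡ suc v
  hγ = h-frac (adjacent⇒coprimeˡ adj) (ℕP.<⇒≤ (adjacent-numerator-< adj u'≤v'))
  hβ : h β ≡ suc v'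
  hβ = h-frac (adjacent⇒coprimeʳ adj) u'≤v'
  hγ≤Q : h γ ≤ Q
  hγ≤Q = subst (_≤ Q) (sym hγ) v≤Q
  hβ≤Q : h β ≤ Q
  hβ≤Q = subst (_≤ Q) (sym hβ) v'≤Q
  γ≢β : ¬ (γ ≡₁ β)
  γ≢β γ≡β = ℕP.<⇒≱ (subst₂ (λ a b → Q < a + b) v≡1 v'≡1 Q<v+v') 2≤Q
    where
    v≡v' : suc v ≡ suc v'
    v≡v' = trans (sym hγ) (trans (cong ↧ₙ_ γ≡β) hβ)
    v≡1 : suc v ≡ 1
    v≡1 = adjacent⇒coprime-denominators adj (∣-refl , subst (suc v ∣_) v≡v' ∣-refl)
    v'≡1 : suc v' ≡ 1
    v'≡1 = trans (sym v≡v') v≡1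
  no-point-between : ∀ x → h x ≤ Q → ¬ InArc γ β x
  no-point-between x hx≤Q arc =
    ℕP.<⇒≱ Q<v+v' (ℕP.≤-trans (between-adjacent⇒v+v'≤denominator adj (red x) γ<x x<β) hx≤Q)
    where
    γ<β : γ ℚ.< β
    γ<β = adjacent⇒< adj (s≤s z≤n)
    between : γ ℚ.< red x × red x ℚ.< β
    between = InArc⇒between {x = x} (frac-nonneg {u} (s≤s z≤n)) (ℚP.<⇒≤ γ<β) (frac-≤1 {u'} (s≤s z≤n) u'≤v') arc
    γ<x : γ ℚ.< red x
    γ<x = proj₁ between
    x<β : red x ℚ.< β
    x<β = proj₂ between

farey-neighbours : ∀ {u v U V u' v'} → Adjacent u v U V → Adjacent U V u' v' →
  U ≤ V → u' ≤ v' → 2 ≤ V → v ≤ V → v' ≤ V →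
  IsPrev (h (frac U V)) (frac U V) (frac u v) × IsNext (h (frac U V)) (frac U V) (frac u' v')
farey-neighbours {u} {v} {U} {V} {u'} {v'} left right U≤V u'≤v' 2≤V v≤V v'≤V =
  subst (λ Q → IsPrev Q β (frac u v) × IsNext Q β (frac u' v')) (sym hβ)
    ( proj₁ (adjacent⇒consecutive left U≤V 2≤V v≤V ℕP.≤-refl (ℕP.m<n+m V (adjacent⇒1≤v left)))
    , proj₂ (adjacent⇒consecutive right u'≤v' 2≤V ℕP.≤-refl v'≤V (ℕP.m<m+n V (adjacent⇒1≤v' right u'≤v'))))
  where
  β = frac U V
  hβ : h β ≡ V
  hβ = h-frac {U} {V} (adjacent⇒coprimeʳ left) U≤V

-- interm a n m is intermediate (P a n) (Qd a n) (P a (suc n)) (Qd a (suc n)) m.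
intermediate : ℕ → ℕ → ℕ → ℕ → ℕ → ℚ
intermediate u v u' v' k = frac (k * u' + u) (k * v' + v)

module _ {u v u' v' : ℕ} (adj : Adjacent u v u' v') where

  open Adjacent adj

  adjacent-extendˡ : ∀ k → Adjacent (k * u' + u) (k * v' + v) u' v'
  adjacent-extendˡ k = adjacent (begin
    u' * (k * v' + v)           ≡⟨ solve (u ∷ v ∷ u' ∷ v' ∷ k ∷ []) ⟩
    k * u' * v' + u' * v        ≡⟨ cong (λ t → k * u' * v' + t) determinant ⟩
    k * u' * v' + (1 + u * v')  ≡⟨ solve (u ∷ v ∷ u' ∷ v' ∷ k ∷ []) ⟩
    1 + (k * u' + u) * v'       ∎)
    where open ≡-Reasoning

  adjacent-extendʳ : ∀ k → Adjacent u v (k * u + u') (k * v + v')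
  adjacent-extendʳ k = adjacent (begin
    (k * u + u') * v            ≡⟨ solve (u ∷ v ∷ u' ∷ v' ∷ k ∷ []) ⟩
    k * u * v + u' * v          ≡⟨ cong (λ t → k * u * v + t) determinant ⟩
    k * u * v + (1 + u * v')    ≡⟨ solve (u ∷ v ∷ u' ∷ v' ∷ k ∷ []) ⟩
    1 + u * (k * v + v')        ∎)
    where open ≡-Reasoning

  rising-intermediates-adjacent : ∀ k → Adjacent (k * u' + u) (k * v' + v) (suc k * u' + u) (suc k * v' + v)
  rising-intermediates-adjacent k = adjacent (begin
    (suc k * u' + u) * (k * v' + v)                          ≡⟨ solve (u ∷ v ∷ u' ∷ v' ∷ k ∷ []) ⟩
    (k * u' + u) * (k * v' + v) + k * u' * v' + u' * v       ≡⟨ cong (λ t → (k * u' + u) * (k * v' + v) + k * u' * v' + t) determinant ⟩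
    (k * u' + u) * (k * v' + v) + k * u' * v' + (1 + u * v') ≡⟨ solve (u ∷ v ∷ u' ∷ v' ∷ k ∷ []) ⟩
    1 + (k * u' + u) * (suc k * v' + v)                      ∎)
    where open ≡-Reasoning

  falling-intermediates-adjacent : ∀ k → Adjacent (suc k * u + u') (suc k * v + v') (k * u + u') (k * v + v')
  falling-intermediates-adjacent k = adjacent (begin
    (k * u + u') * (suc k * v + v')                          ≡⟨ solve (u ∷ v ∷ u' ∷ v' ∷ k ∷ []) ⟩
    (k * u + u') * (k * v + v') + k * u * v + u' * v         ≡⟨ cong (λ t → (k * u + u') * (k * v + v') + k * u * v + t) determinant ⟩
    (k * u + u') * (k * v + v') + k * u * v + (1 + u * v')   ≡⟨ solve (u ∷ v ∷ u' ∷ v' ∷ k ∷ []) ⟩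
    1 + (suc k * u + u') * (k * v + v')                      ∎)
    where open ≡-Reasoning

  private
    rising-step : ∀ k → intermediate u v u' v' k ℚ.< intermediate u v u' v' (suc k)
    rising-step k = adjacent⇒< (rising-intermediates-adjacent k) (ℕP.≤-trans (adjacent⇒1≤v adj) (ℕP.m≤n+m v (suc k * v')))

    falling-step : ∀ k → 1 ≤ k * v + v' → intermediate u' v' u v (suc k) ℚ.< intermediate u' v' u v k
    falling-step k = adjacent⇒< (falling-intermediates-adjacent k)

  intermediates-increasing : ∀ {j k} → j ≤ k → intermediate u v u' v' j ℚ.≤ intermediate u v u' v' k
  intermediates-increasing {j} j≤k = go (ℕP.≤⇒≤′ j≤k)
    where
    go : ∀ {k} → j ≤′ k → intermediate u v u' v' j ℚ.≤ intermediate u v u' v' k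
    go ≤′-refl = ℚP.≤-refl
    go (≤′-step {k} j≤′k) = ℚP.≤-trans (go j≤′k) (ℚP.<⇒≤ (rising-step k))

  intermediates-increasing-strict : ∀ {j k} → j < k → intermediate u v u' v' j ℚ.< intermediate u v u' v' k
  intermediates-increasing-strict {j} j<k = ℚP.<-≤-trans (rising-step j) (intermediates-increasing j<k)

  intermediates-decreasing : ∀ {j k} → 1 ≤ j * v + v' → j ≤ k →
                             intermediate u' v' u v k ℚ.≤ intermediate u' v' u v j
  intermediates-decreasing {j} 1≤den j≤k = go (ℕP.≤⇒≤′ j≤k)
    where
    go : ∀ {k} → j ≤′ k → intermediate u' v' u v k ℚ.≤ intermediate u' v' u v j
    go ≤′-refl = ℚP.≤-refl
    go (≤′-step {k} j≤′k) = ℚP.≤-trans (ℚP.<⇒≤ (falling-step k 1≤den[k])) (go j≤′k)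
      where
      1≤den[k] : 1 ≤ k * v + v'
      1≤den[k] = ℕP.≤-trans 1≤den (ℕP.+-monoˡ-≤ v' (ℕP.*-monoˡ-≤ v (ℕP.≤′⇒≤ j≤′k)))

  intermediates-decreasing-strict : ∀ {j k} → 1 ≤ j * v + v' → j < k →
                                    intermediate u' v' u v k ℚ.< intermediate u' v' u v j
  intermediates-decreasing-strict {j} 1≤den j<k =
    ℚP.≤-<-trans (intermediates-decreasing 1≤den[1+j] j<k) (falling-step j 1≤den)
    where
    1≤den[1+j] : 1 ≤ suc j * v + v'
    1≤den[1+j] = ℕP.≤-trans 1≤den (ℕP.+-monoˡ-≤ v' (ℕP.*-monoˡ-≤ v (ℕP.n≤1+n j)))

-- Convergents

≤-<α : ∀ {a x y} → x ℚ.≤ y → y <α[ a ] → x <α[ a ]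
≤-<α x≤y (k , y<c) = k , ℚP.≤-<-trans x≤y y<c

α<-≤ : ∀ {a x y} → α[ a ]< x → x ℚ.≤ y → α[ a ]< y
α<-≤ (k , c<x) x≤y = k , ℚP.<-≤-trans c<x x≤y

-- P a i / Qd a i = p_{i-2} / q_{i-2}, and p_{i-1} q_{i-2} - p_{i-2} q_{i-1} = (-1)^i.
module _ (a : ℕ → ℕ) where

  convergents-adjacent-even : ∀ k →
    Adjacent (P a (2 * k)) (Qd a (2 * k)) (P a (suc (2 * k))) (Qd a (suc (2 * k)))
  convergents-adjacent-odd : ∀ k →
    Adjacent (P a (suc (suc (2 * k)))) (Qd a (suc (suc (2 * k)))) (P a (suc (2 * k))) (Qd a (suc (2 * k)))

  convergents-adjacent-even zero = adjacent refl
  convergents-adjacent-even (suc k) =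
    subst (λ i → Adjacent (P a i) (Qd a i) (P a (suc i)) (Qd a (suc i))) (sym (ℕP.*-suc 2 k))
      (adjacent-extendʳ (convergents-adjacent-odd k) (digit a (suc (2 * k))))
  convergents-adjacent-odd k = adjacent-extendˡ (convergents-adjacent-even k) (digit a (2 * k))

module _ (a : ℕ → ℕ) (a-pos : ∀ k → 1 ≤ a (suc k)) where

  Qd-pos : ∀ i → 1 ≤ i → 1 ≤ Qd a (suc i)
  Qd-pos (suc zero) _ = s≤s z≤n
  Qd-pos (suc (suc i)) _ = ℕP.≤-trans (ℕP.*-mono-≤ (a-pos i) (Qd-pos (suc i) (s≤s z≤n))) (ℕP.m≤m+n _ _)

  P≤Qd : ∀ i → P a (suc (suc i)) ≤ Qd a (suc (suc i))
  P≤Qd i = proj₁ (two-consecutive i)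
    where
    two-consecutive : ∀ i → P a (suc (suc i)) ≤ Qd a (suc (suc i)) × P a (suc (suc (suc i))) ≤ Qd a (suc (suc (suc i)))
    two-consecutive zero =
      z≤n , subst₂ _≤_ (cong (_+ 1) (sym (ℕP.*-zeroʳ (a 1)))) (sym (trans (ℕP.+-identityʳ _) (ℕP.*-identityʳ (a 1)))) (a-pos 0)
    two-consecutive (suc i) = proj₂ ih , ℕP.+-mono-≤ (ℕP.*-monoʳ-≤ (a (suc (suc i))) (proj₂ ih)) (proj₁ ih)
      where
      ih : P a (suc (suc i)) ≤ Qd a (suc (suc i)) × P a (suc (suc (suc i))) ≤ Qd a (suc (suc (suc i)))
      ih = two-consecutive i

  interm-num≤den : ∀ n {m} → 1 ≤ m → m * P a (suc (suc n)) + P a (suc n) ≤ m * Qd a (suc (suc n)) + Qd a (suc n)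
  interm-num≤den zero {m} 1≤m =
    subst₂ _≤_ (cong (_+ 1) (sym (ℕP.*-zeroʳ m))) (sym (trans (ℕP.+-identityʳ _) (ℕP.*-identityʳ m))) 1≤m
  interm-num≤den (suc i) {m} _ = ℕP.+-mono-≤ (ℕP.*-monoʳ-≤ m (P≤Qd (suc i))) (P≤Qd i)

  even-convergents-increasing : ∀ j → conv a (suc (2 * j)) ℚ.< conv a (suc (2 * suc j))
  even-convergents-increasing j =
    subst (ℚ._< conv a (suc (2 * suc j))) (cong (λ i → frac (P a i) (Qd a i)) (ℕP.*-suc 2 j))
      (intermediates-increasing-strict (convergents-adjacent-even a (suc j)) (a-pos _))

  odd-convergents-decreasing : ∀ j → conv a (suc (suc (2 * suc j))) ℚ.< conv a (suc (suc (2 * j)))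
  odd-convergents-decreasing j = subst (conv a (suc (suc (2 * suc j))) ℚ.<_) (cong (conv a) (ℕP.*-suc 2 j))
    (intermediates-decreasing-strict (convergents-adjacent-odd a (suc j)) (Qd-pos (2 * suc j) (s≤s z≤n)) (a-pos _))

  even-convergent<α : ∀ k → conv a (suc (2 * k)) <α[ a ]
  even-convergent<α k = suc k , even-convergents-increasing k

  α<odd-convergent : ∀ k → α[ a ]< conv a (suc (suc (2 * k)))
  α<odd-convergent k = suc k , odd-convergents-decreasing k

OddNeighbours : (ℕ → ℕ) → ℕ → ℕ → Set
OddNeighbours a n m =
  IsPrev (h (interm a n m)) (interm a n m) (conv a n)
  × IsNext (h (interm a n m)) (interm a n m) (interm a n (m ∸ 1))
  × αInArc a (conv a n) (interm a n m)

EvenNeighbours : (ℕ → ℕ) → ℕ → ℕ → Set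
EvenNeighbours a n m =
  IsPrev (h (interm a n m)) (interm a n m) (interm a n (m ∸ 1))
  × IsNext (h (interm a n m)) (interm a n m) (conv a n)
  × αInArc a (interm a n m) (conv a n)

odd-form : ∀ n → n % 2 ≡ 1 → ∃ λ k → n ≡ suc (2 * k)
odd-form n n%2≡1 = n ℕ./ 2 , trans (ℕD.m≡m%n+[m/n]*n n 2) (cong₂ _+_ n%2≡1 (ℕP.*-comm (n ℕ./ 2) 2))

even-form : ∀ n → 1 ≤ n → n % 2 ≡ 0 → ∃ λ k → n ≡ 2 * suc k
even-form n 1≤n n%2≡0 with n ℕ./ 2 | trans (ℕD.m≡m%n+[m/n]*n n 2) (cong₂ _+_ n%2≡0 (ℕP.*-comm (n ℕ./ 2) 2))
... | zero  | n≡0 with () ← subst (1 ≤_) n≡0 1≤n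
... | suc k | n≡2*suc[k] = k , n≡2*suc[k]

module _ (a : ℕ → ℕ) (a-pos : ∀ k → 1 ≤ a (suc k)) where

  odd-neighbours : ∀ {n m} → n % 2 ≡ 1 → 1 ≤ m → m ≤ a n → ¬ (interm a n m ≡₁ 0ℚ) → OddNeighbours a n m
  odd-neighbours {n} {suc m'} n-odd _ m≤a β≢0 with k , refl ← odd-form n n-odd =
    proj₁ neighbours , proj₂ neighbours ,
    inj₁ (subst₂ ℚ._<_ (sym red-γ) (sym red-β) (adjacent⇒< adj-γβ 1≤V) , γ<α , α<β)
    where
    m = suc m'
    A = P a (suc n); B = Qd a (suc n); C = P a n; D = Qd a n
    U = m * A + C; V = m * B + D
    γ = conv a n; β = interm a n m
    adj : Adjacent A B C D
    adj = convergents-adjacent-odd a k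
    adj-γβ : Adjacent A B U V
    adj-γβ = adjacent-extendʳ adj m
    adj-ββ₋ : Adjacent U V (m' * A + C) (m' * B + D)
    adj-ββ₋ = falling-intermediates-adjacent adj m'
    U≤V : U ≤ V
    U≤V = interm-num≤den a a-pos (2 * k) {m} (s≤s z≤n)
    -- β ≢ 0 excludes n = m = 1, where β = 1/1 is not a proper fraction.
    proper : 1 ≤ U × U < V
    proper = frac-proper {U} {V} (adjacent⇒coprimeʳ adj-γβ) U≤V β≢0
    2≤V : 2 ≤ V
    2≤V = ℕP.≤-<-trans (proj₁ proper) (proj₂ proper)
    1≤V : 1 ≤ V
    1≤V = ℕP.<⇒≤ 2≤V
    neighbours : IsPrev (h β) β γ × IsNext (h β) β (interm a n m')
    neighbours = farey-neighbours adj-γβ adj-ββ₋ U≤V (adjacent-numerator-≤ adj-ββ₋ (proj₁ proper) (proj₂ proper)) 2≤V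
      (ℕP.≤-trans (ℕP.m≤m+n B (m' * B)) (ℕP.m≤m+n (m * B) D)) (ℕP.+-monoˡ-≤ D (ℕP.m≤n+m (m' * B) B))
    red-β : red β ≡ β
    red-β = red-frac {U} (proj₂ proper)
    red-γ : red γ ≡ γ
    red-γ = red-frac {A} (adjacent-numerator-< adj-γβ U≤V)
    γ<α : red γ <α[ a ]
    γ<α = subst (_<α[ a ]) (sym red-γ) (even-convergent<α a a-pos k)
    α<β : α[ a ]< red β
    α<β = subst (α[ a ]<_) (sym red-β) (α<-≤ {a} (α<odd-convergent a a-pos k) (intermediates-decreasing adj 1≤V m≤a))

  even-neighbours : ∀ {n m} → 1 ≤ n → n % 2 ≡ 0 → 1 ≤ m → m ≤ a n → ¬ (interm a n m ≡₁ 0ℚ) → EvenNeighbours a n m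
  even-neighbours {n} {suc m'} 1≤n n-even _ m≤a β≢0 with k , refl ← even-form n 1≤n n-even =
    proj₁ neighbours , proj₂ neighbours , α-in-arc (ℕP.m≤n⇒m<n∨m≡n A≤B)
    where
    m = suc m'
    A = P a (suc n); B = Qd a (suc n); C = P a n; D = Qd a n
    U = m * A + C; V = m * B + D
    γ = conv a n; β = interm a n m
    adj : Adjacent C D A B
    adj = convergents-adjacent-even a (suc k)
    adj-βγ : Adjacent U V A B
    adj-βγ = adjacent-extendˡ adj m
    A≤B : A ≤ B
    A≤B = P≤Qd a a-pos (ℕ.pred n)
    U≤V : U ≤ V
    U≤V = interm-num≤den a a-pos (ℕ.pred n) {m} (s≤s z≤n)
    proper : 1 ≤ U × U < V
    proper = frac-proper {U} {V} (adjacent⇒coprimeˡ adj-βγ) U≤V β≢0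
    2≤V : 2 ≤ V
    2≤V = ℕP.≤-<-trans (proj₁ proper) (proj₂ proper)
    1≤V : 1 ≤ V
    1≤V = ℕP.<⇒≤ 2≤V
    neighbours : IsPrev (h β) β (interm a n m') × IsNext (h β) β γ
    neighbours = farey-neighbours (rising-intermediates-adjacent adj m') adj-βγ U≤V A≤B 2≤V
      (ℕP.+-monoˡ-≤ D (ℕP.m≤n+m (m' * B) B)) (ℕP.≤-trans (ℕP.m≤m+n B (m' * B)) (ℕP.m≤m+n (m * B) D))
    red-β : red β ≡ β
    red-β = red-frac {U} (proj₂ proper)
    β<α : red β <α[ a ]
    β<α = subst (_<α[ a ]) (sym red-β) (≤-<α {a} (intermediates-increasing adj m≤a) (even-convergent<α a a-pos (suc k)))
    -- p_{n-1} = q_{n-1} only for n = 2 and a_1 = 1: then β'' = 1 is 0 in ℚ/ℤ and the arc I(β, β'') contains 0.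
    α-in-arc : A < B ⊎ A ≡ B → αInArc a β γ
    α-in-arc (inj₁ A<B) =
      inj₁ (subst₂ ℚ._<_ (sym red-β) (sym red-γ) (adjacent⇒< adj-βγ (adjacent⇒1≤v' adj-βγ A≤B)) , β<α , α<γ)
      where
      red-γ : red γ ≡ γ
      red-γ = red-frac {A} A<B
      α<γ : α[ a ]< red γ
      α<γ = subst (α[ a ]<_) (trans (cong (conv a) (sym (ℕP.*-suc 2 k))) (sym red-γ)) (α<odd-convergent a a-pos k)
    α-in-arc (inj₂ A≡B) = inj₂ (subst₂ ℚ._<_ (sym red-γ) (sym red-β) (frac-pos (proj₁ proper) 1≤V) , inj₁ β<α)
      where
      B≡1 : B ≡ 1
      B≡1 = adjacent⇒coprimeʳ adj (subst (B ∣_) (sym A≡B) ∣-refl , ∣-refl)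
      red-γ : red γ ≡ 0ℚ
      red-γ = cong₂ (λ x y → red (frac x y)) (trans A≡B B≡1) B≡1

lemma4 : (a : ℕ → ℕ) → (∀ k → 1 ≤ a (suc k)) →
         (n m : ℕ) → 1 ≤ n → 1 ≤ m → m ≤ a n →
         ¬ (interm a n m ≡₁ 0ℚ) →
         (n % 2 ≡ 1 →
            IsPrev (h (interm a n m)) (interm a n m) (conv a n)
            × IsNext (h (interm a n m)) (interm a n m) (interm a n (m ∸ 1))
            × αInArc a (conv a n) (interm a n m))
         × (n % 2 ≡ 0 →
            IsPrev (h (interm a n m)) (interm a n m) (interm a n (m ∸ 1))
            × IsNext (h (interm a n m)) (interm a n m) (conv a n)
            × αInArc a (interm a n m) (conv a n))
lemma4 a a-pos n m 1≤n 1≤m m≤a β≢0 =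
  (λ n-odd → odd-neighbours a a-pos n-odd 1≤m m≤a β≢0) ,
  (λ n-even → even-neighbours a a-pos 1≤n n-even 1≤m m≤a β≢0)
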